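{- Let $k\ge 3$, let $G=(V,E)$ be an absolute retract of $k$-chromatic graphs and let $c$ be a proper $k$-colouring of $G$. Then $\max_{1\le i\le k} d_i\le \mathrm{diam}(G)\le 1+\max_{1\le i\le k} d_i$. Moreover, if $\mathrm{diam}(G)\ge 3$, then $\mathrm{diam}(G)=1+\max_{1\le i\le k} d_i$ if and only if either $\max_{1\le i\le k} d_i=2$, or there exist colours $i\ne j$ with $d_i=d_j=\max_{1\le p\le k} d_p$ and an $i$-peripheral vertex all of whose neighbours coloured $j$ are $j$-peripheral.
   Context: Graphs are finite, simple (no loops), connected; $d_G$ is shortest-path distance. For colour $i$, $V_i=\{v: c(v)=i\}$; for $v\in V_i$, $e_i(v)=\max\{d_G(u,v): u\in V_i\}$; $d_i=\max\{e_i(v): v\in V_i\}$; $v\in V_i$ is $i$-peripheral if $e_i(v)=d_i$. A $k$-chromatic graph has chromatic number exactly $k$. A subgraph $H$ of $G'$ is isometric if distances between vertices of $H$ agree in $H$ and $G'$, isochromatic if same chromatic number. A retract of $G'$ is the image of $G'$ under an idempotent edge-preserving map. An absolute retract of $k$-chromatic graphs is a $k$-chromatic graph $H$ such that whenever $H$ is an isometric and isochromatic subgraph of a $k$-chromatic graph $G'$, $H$ is a retract of $G'$. -}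

module Defs where

open import Data.Nat using (ℕ; zero; suc; _≤_)
open import Data.Fin using (Fin)
open import Data.Bool using (Bool; true; false)
open import Data.Product using (Σ; ∃; _×_; _,_)
open import Relation.Binary.PropositionalEquality using (_≡_; _≢_)
open import Function using (Injective)

record Graph (n : ℕ) : Set where
  field
    adj    : Fin n → Fin n → Bool
    adj-sym : ∀ u v → adj u v ≡ adj v u
    loopless : ∀ v → adj v v ≡ false

open Graph public

Edge : ∀ {n} → Graph n → Fin n → Fin n → Set
Edge G u v = adj G u v ≡ true

data Walk {n : ℕ} (G : Graph n) : Fin n → Fin n → ℕ → Set where
  here : ∀ {v} → Walk G v v 0
  step : ∀ {u w v ℓ} → Edge G u w → Walk G w v ℓ → Walk G u v (suc ℓ)

Dist : ∀ {n} → Graph n → Fin n → Fin n → ℕ → Set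
Dist G u v d = Walk G u v d × (∀ ℓ → Walk G u v ℓ → d ≤ ℓ)

Connected : ∀ {n} → Graph n → Set
Connected {n} G = ∀ (u v : Fin n) → ∃ λ ℓ → Walk G u v ℓ

Diam : ∀ {n} → Graph n → ℕ → Set
Diam {n} G D =
  (Σ (Fin n) λ u → Σ (Fin n) λ v → Dist G u v D) ×
  (∀ u v ℓ → Dist G u v ℓ → ℓ ≤ D)

Proper : ∀ {n k} → Graph n → (Fin n → Fin k) → Set
Proper G c = ∀ u v → Edge G u v → c u ≢ c v

Colourable : ∀ {n} → Graph n → ℕ → Set
Colourable {n} G k = Σ (Fin n → Fin k) λ c → Proper G c

Chromatic : ∀ {n} → Graph n → ℕ → Set
Chromatic G k = Colourable G k × (∀ m → Colourable G m → k ≤ m)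

Ecc : ∀ {n k} → Graph n → (Fin n → Fin k) → Fin k → Fin n → ℕ → Set
Ecc {n} G c i v e =
  (Σ (Fin n) λ u → c u ≡ i × Dist G u v e) ×
  (∀ u ℓ → c u ≡ i → Dist G u v ℓ → ℓ ≤ e)

ColourDiam : ∀ {n k} → Graph n → (Fin n → Fin k) → Fin k → ℕ → Set
ColourDiam {n} G c i D =
  (Σ (Fin n) λ v → c v ≡ i × Ecc G c i v D) ×
  (∀ v e → c v ≡ i → Ecc G c i v e → e ≤ D)

Peripheral : ∀ {n k} → Graph n → (Fin n → Fin k) → Fin k → Fin n → Set
Peripheral G c i v = c v ≡ i × Σ ℕ λ D → ColourDiam G c i D × Ecc G c i v D

MaxColourDiam : ∀ {n k} → Graph n → (Fin n → Fin k) → ℕ → Set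
MaxColourDiam {n} {k} G c M =
  (Σ (Fin k) λ i → ColourDiam G c i M) ×
  (∀ i D → ColourDiam G c i D → D ≤ M)

IsometricSubgraph : ∀ {n m} → Graph n → Graph m → (Fin n → Fin m) → Set
IsometricSubgraph {n} H G' f =
  Injective _≡_ _≡_ f ×
  (∀ u v → Edge H u v → Edge G' (f u) (f v)) ×
  (∀ u v d → (Dist H u v d → Dist G' (f u) (f v) d) × (Dist G' (f u) (f v) d → Dist H u v d))

-- H (embedded by f) is a retract of G': an edge-preserving r : G' → H with r ∘ f = id
-- (equivalently f ∘ r is an idempotent edge-preserving self-map of G' with image f(H)).
IsRetract : ∀ {n m} → Graph n → Graph m → (Fin n → Fin m) → Set
IsRetract {n} {m} H G' f =
  Σ (Fin m → Fin n) λ r →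
    (∀ x y → Edge G' x y → Edge H (r x) (r y)) × (∀ x → r (f x) ≡ x)

AbsRetract : ℕ → ∀ {n} → Graph n → Set
AbsRetract k {n} H =
  Connected H × Chromatic H k ×
  (∀ m (G' : Graph m) (f : Fin n → Fin m) →
     Connected G' → Chromatic G' k →
     IsometricSubgraph H G' f → Chromatic H k →
     IsRetract H G' f)

-- Glue to G a hub adjacent to a vertex set Z and joined to every vertex of a set Y by a
-- path of length N. If G stays an isometric subgraph (witnessed, for every b, by a 1-Lipschitz
-- extension of dist · b to the new vertices) and the new graph is still k-colourable, the
-- retraction onto G sends the hub to a vertex adjacent to all of Z and within N of all of Y.
-- With Z = N[v] and Y = ∅ this shows that every vertex sees every other colour, whence
-- diam G ≤ 1 + max dᵢ; and if diam G = 1 + max dᵢ, a diametral pair u, v has differently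
-- coloured ends and the neighbours of v coloured c u are (c u)-peripheral. Conversely, if
-- diam G ≤ max dᵢ = M ≥ 3, take Z = {v} ∪ (N(v) ∖ Vⱼ), Y = Vⱼ and N = M − 1: the image of the
-- hub is a neighbour of v of colour j within M − 1 of all of Vⱼ, so it is not j-peripheral.

module Submission where

open import Defs
open import Level using (0ℓ)
open import Data.Nat using (ℕ; zero; suc; _≤_; _<_; _+_; _∸_; _*_; _⊔_; _⊓_; z≤n; s≤s)
open import Data.Nat.Properties
open import Data.Nat.Induction using (<-rec)
open import Data.Fin using (Fin; zero; suc; toℕ; inject₁; fromℕ)
open import Data.Fin.Properties using (any?; +↔⊎; *↔×; toℕ-inject₁; toℕ-fromℕ)
  renaming (_≟_ to _≟ᶠ_; suc-injective to sucᶠ-injective)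
open import Data.Fin.Induction using (<-weakInduction)
open import Data.Bool using (true)
open import Data.Bool.Properties using (∨-comm) renaming (_≟_ to _≟ᵇ_)
open import Data.List using (List; filter; allFin)
open import Data.List.Extrema.Nat using (argmax; argmax-all; f[xs]≤f[argmax])
open import Data.List.Membership.Propositional.Properties using (∈-filter⁺; ∈-allFin)
open import Data.List.Relation.Unary.All using (lookup)
open import Data.List.Relation.Unary.All.Properties using (all-filter)
open import Data.Empty using (⊥; ⊥-elim)
open import Data.Sum using (_⊎_; inj₁; inj₂; [_,_])
open import Data.Sum.Properties using (inj₁-injective; inj₂-injective)
open import Data.Sum.Function.Propositional using (_⊎-↔_)
open import Data.Product using (Σ; ∃; ∃-syntax; _×_; _,_; proj₁; proj₂)
open import Data.Product.Properties using (,-injectiveʳ)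
open import Function using (_∘_; Injective)
open import Function.Bundles using (_↔_; _⇔_; mk⇔; Inverse)
open import Function.Construct.Composition using (_↔-∘_)
open import Function.Properties.Inverse using (↔-refl)
open import Relation.Nullary using (Dec; yes; no; ¬_; does; _×-dec_; _⊎-dec_; ¬?)
open import Relation.Nullary.Decidable using (map′; dec-true; dec-false; decidable-stable)
open import Relation.Unary using (Pred; Decidable; ∅; _∈_)
open import Relation.Unary.Properties using (∅?)
open import Relation.Binary.PropositionalEquality
  using (_≡_; _≢_; ≢-sym; refl; sym; trans; subst; subst₂; cong)

least : ∀ {p} {P : Pred ℕ p} → Decidable P → ∀ {ℓ} → P ℓ → ∃[ d ] P d × (∀ {m} → P m → d ≤ m)
least {P = P} P? {ℓ} = <-rec (λ ℓ → P ℓ → ∃[ d ] P d × (∀ {m} → P m → d ≤ m)) search ℓ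
  where
  search : ∀ ℓ → (∀ {m} → m < ℓ → P m → ∃[ d ] P d × (∀ {m} → P m → d ≤ m)) →
           P ℓ → ∃[ d ] P d × (∀ {m} → P m → d ≤ m)
  search ℓ smaller pℓ with anyUpTo? P? ℓ
  ... | yes (m , m<ℓ , pm) = smaller m<ℓ pm
  ... | no none = ℓ , pℓ , λ {m} pm → ≮⇒≥ λ m<ℓ → none (m , m<ℓ , pm)

maximiser : ∀ {n p} {P : Pred (Fin n) p} → Decidable P → (f : Fin n → ℕ) → ∀ {x₀} → P x₀ →
            ∃[ x ] P x × (∀ y → P y → f y ≤ f x)
maximiser {n} P? f {x₀} px₀ =
  x , argmax-all f px₀ (all-filter P? (allFin n)) ,
  λ y py → lookup (f[xs]≤f[argmax] x₀ candidates) (∈-filter⁺ P? (∈-allFin y) py)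
  where
  candidates : List (Fin n)
  candidates = filter P? (allFin n)

  x : Fin n
  x = argmax f x₀ candidates

Homomorphism : ∀ {n m} → Graph n → Graph m → (Fin n → Fin m) → Set
Homomorphism G G' h = ∀ x y → Edge G x y → Edge G' (h x) (h y)

mapᵂ : ∀ {n m} {G : Graph n} {G' : Graph m} {h : Fin n → Fin m} → Homomorphism G G' h →
       ∀ {u v ℓ} → Walk G u v ℓ → Walk G' (h u) (h v) ℓ
mapᵂ hom here = here
mapᵂ hom (step e p) = step (hom _ _ e) (mapᵂ hom p)

Edge-sym : ∀ {n} (G : Graph n) {u v} → Edge G u v → Edge G v u
Edge-sym G {u} {v} e = trans (adj-sym G v u) e

Edge-irrefl : ∀ {n} (G : Graph n) {u} → ¬ Edge G u u
Edge-irrefl G {u} e with trans (sym e) (loopless G u)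
... | ()

module _ {n} {G : Graph n} where

  _++ᵂ_ : ∀ {u w v a b} → Walk G u w a → Walk G w v b → Walk G u v (a + b)
  here ++ᵂ q = q
  step e p ++ᵂ q = step e (p ++ᵂ q)

  reverse : ∀ {u v ℓ} → Walk G u v ℓ → Walk G v u ℓ
  reverse here = here
  reverse {ℓ = suc ℓ} (step e p) =
    subst (Walk G _ _) (+-comm ℓ 1) (reverse p ++ᵂ step (Edge-sym G e) here)

  walk-lipschitz : (ψ : Fin n → ℕ) → (∀ {x y} → Edge G x y → ψ x ≤ suc (ψ y)) →
                   ∀ {u v ℓ} → Walk G u v ℓ → ψ u ≤ ℓ + ψ v
  walk-lipschitz ψ lip here = ≤-refl
  walk-lipschitz ψ lip (step e p) = ≤-trans (lip e) (s≤s (walk-lipschitz ψ lip p))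

  Dist-sym : ∀ {u v d} → Dist G u v d → Dist G v u d
  Dist-sym (p , minimal) = reverse p , λ ℓ q → minimal ℓ (reverse q)

  Dist-unique : ∀ {u v d d'} → Dist G u v d → Dist G u v d' → d ≡ d'
  Dist-unique (p , minimal) (p' , minimal') = ≤-antisym (minimal _ p') (minimal' _ p)

walk? : ∀ {n} (G : Graph n) ℓ u v → Dec (Walk G u v ℓ)
walk? G zero u v = map′ (λ { refl → here }) (λ { here → refl }) (u ≟ᶠ v)
walk? G (suc ℓ) u v =
  map′ (λ (w , e , p) → step e p) (λ { (step e p) → _ , e , p })
       (any? λ w → (adj G u w ≟ᵇ true) ×-dec walk? G ℓ w v)

Dist-exists : ∀ {n} (G : Graph n) → Connected G → ∀ u v → ∃ (Dist G u v)
Dist-exists G conn u v with least (λ ℓ → walk? G ℓ u v) (proj₂ (conn u v))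
... | d , p , minimal = d , p , λ ℓ q → minimal q

module Distance {n} (G : Graph n) (conn : Connected G) where

  abstract
    dist : Fin n → Fin n → ℕ
    dist u v = proj₁ (Dist-exists G conn u v)

    dist-Dist : ∀ u v → Dist G u v (dist u v)
    dist-Dist u v = proj₂ (Dist-exists G conn u v)

  dist≤walk : ∀ {u v ℓ} → Walk G u v ℓ → dist u v ≤ ℓ
  dist≤walk p = proj₂ (dist-Dist _ _) _ p

  Dist⇒≡dist : ∀ {u v d} → Dist G u v d → d ≡ dist u v
  Dist⇒≡dist D = Dist-unique D (dist-Dist _ _)

  dist-edge : ∀ {x y} b → Edge G x y → dist x b ≤ suc (dist y b)
  dist-edge {x} {y} b e = dist≤walk (step e (proj₁ (dist-Dist y b)))

  dist-sym : ∀ u v → dist u v ≡ dist v u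
  dist-sym u v = Dist-unique (dist-Dist u v) (Dist-sym (dist-Dist v u))

  Dist≤suc-dist : ∀ {u v w d} → Dist G u v d → Edge G w v → d ≤ suc (dist u w)
  Dist≤suc-dist {u} {v} {w} {d} (_ , minimal) e =
    subst (d ≤_) (+-comm (dist u w) 1) (minimal _ (proj₁ (dist-Dist u w) ++ᵂ step e here))

  dist-self : ∀ b → dist b b ≡ 0
  dist-self b = n≤0⇒n≡0 (dist≤walk here)

module ColourDistances {n k} (G : Graph n) (conn : Connected G) (c : Fin n → Fin k) where
  open Distance G conn

  Ecc-exists : ∀ {i v} → c v ≡ i → ∃ (Ecc G c i v)
  Ecc-exists {i} {v} cv with maximiser (λ u → c u ≟ᶠ i) (λ u → dist u v) cv
  ... | x , cx , farthest =
    dist x v , (x , cx , dist-Dist x v) ,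
    λ u ℓ cu D → subst (_≤ dist x v) (sym (Dist⇒≡dist D)) (farthest u cu)

  Ecc-unique : ∀ {i v e e'} → Ecc G c i v e → Ecc G c i v e' → e ≡ e'
  Ecc-unique ((x , cx , D) , bound) ((x' , cx' , D') , bound') =
    ≤-antisym (bound' x _ cx D) (bound x' _ cx' D')

  ecc : Fin n → ℕ
  ecc v = proj₁ (Ecc-exists {c v} refl)

  Ecc-ecc : ∀ {i v} → c v ≡ i → Ecc G c i v (ecc v)
  Ecc-ecc refl = proj₂ (Ecc-exists refl)

  ColourDiam-exists : ∀ {i v} → c v ≡ i → ∃ (ColourDiam G c i)
  ColourDiam-exists {i} cv =
    let x , cx , largest = maximiser (λ u → c u ≟ᶠ i) ecc cv in
    ecc x , (x , cx , Ecc-ecc cx) ,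
    λ v e cv E → subst (_≤ ecc x) (Ecc-unique (Ecc-ecc cv) E) (largest v cv)

  ColourDiam-unique : ∀ {i D D'} → ColourDiam G c i D → ColourDiam G c i D' → D ≡ D'
  ColourDiam-unique ((x , cx , E) , bound) ((x' , cx' , E') , bound') =
    ≤-antisym (bound' x _ cx E) (bound x' _ cx' E')

  module _ {M} (max : MaxColourDiam G c M) where

    sameColour⇒dist≤ : ∀ {u w d} → c u ≡ c w → Dist G u w d → d ≤ M
    sameColour⇒dist≤ {u} {w} {d} cuw D =
      let e , E = Ecc-exists {c w} refl
          d' , CD = ColourDiam-exists {c w} refl
      in ≤-trans (proj₂ E u d cuw D) (≤-trans (proj₂ CD w e refl E) (proj₂ max (c w) d' CD))

    far⇒peripheral : ∀ {j x y} → c x ≡ j → c y ≡ j → M ≤ dist x y →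
                     ColourDiam G c j M × Ecc G c j y M
    far⇒peripheral {j} {x} {y} cx cy far =
      let e , E = Ecc-exists cy
          d , CD = ColourDiam-exists cy
          M≤e : M ≤ e
          M≤e = ≤-trans far (proj₂ E x (dist x y) cx (dist-Dist x y))
          e≤d : e ≤ d
          e≤d = proj₂ CD y e cy E
          d≤M : d ≤ M
          d≤M = proj₂ max j d CD
      in subst (ColourDiam G c j) (≤-antisym d≤M (≤-trans M≤e e≤d)) CD ,
         subst (Ecc G c j y) (≤-antisym (≤-trans e≤d d≤M) M≤e) E

Near : ℕ → ℕ → ℕ → Set
Near d a b = a ≤ d + b × b ≤ d + a

Near-⊔ : ∀ {d a a' b b'} → Near d a a' → Near d b b' → Near d (a ⊔ b) (a' ⊔ b')
Near-⊔ {d} {a} {a'} {b} {b'} (a≤ , a'≤) (b≤ , b'≤) =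
  ⊔-lub (≤-trans a≤ (+-monoʳ-≤ d (m≤m⊔n a' b'))) (≤-trans b≤ (+-monoʳ-≤ d (m≤n⊔m a' b'))) ,
  ⊔-lub (≤-trans a'≤ (+-monoʳ-≤ d (m≤m⊔n a b))) (≤-trans b'≤ (+-monoʳ-≤ d (m≤n⊔m a b)))

∸-suc-near : ∀ a p → Near 1 (a ∸ p) (a ∸ suc p)
∸-suc-near zero zero = z≤n , z≤n
∸-suc-near zero (suc p) = z≤n , z≤n
∸-suc-near (suc a) zero = ≤-refl , m≤n⇒m≤1+n (n≤1+n a)
∸-suc-near (suc a) (suc p) = ∸-suc-near a p

∸-near : ∀ a {x y} → Near 1 x y → Near 1 (a ∸ x) (a ∸ y)
∸-near a {x} {y} (x≤ , y≤) =
  ≤-trans (proj₁ (∸-suc-near a x)) (s≤s (∸-monoʳ-≤ a y≤)) ,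
  ≤-trans (proj₁ (∸-suc-near a y)) (s≤s (∸-monoʳ-≤ a x≤))

interpolate : ℕ → ℕ → ℕ → ℕ → ℕ
interpolate a b N p = (a ∸ p) ⊔ (b ∸ (N ∸ p))

interpolate-step : ∀ a b N p → Near 1 (interpolate a b N p) (interpolate a b N (suc p))
interpolate-step a b N p = Near-⊔ (∸-suc-near a p) (∸-near b (∸-suc-near N p))

interpolate-start : ∀ {a b N} → Near N a b → interpolate a b N 0 ≡ a
interpolate-start {a} {b} {N} (_ , b≤) = m≥n⇒m⊔n≡m (m≤n+o⇒m∸n≤o b N b≤)

interpolate-end : ∀ {a b N} → Near N a b → interpolate a b N N ≡ b
interpolate-end {a} {b} {N} (a≤ , _) rewrite n∸n≡0 N = m≤n⇒m⊔n≡n (m≤n+o⇒m∸n≤o a N a≤)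

module _ {n m} {G : Graph n} {G' : Graph m} (conn : Connected G) {f : Fin n → Fin m} where
  open Distance G conn

  isometric-without-shortcuts : Injective _≡_ _≡_ f → (hom : Homomorphism G G' f) →
    (∀ {u v ℓ} → Walk G' (f u) (f v) ℓ → dist u v ≤ ℓ) → IsometricSubgraph G G' f
  isometric-without-shortcuts inj hom no-shortcut = inj , hom , λ u v d →
    (λ D@(p , _) → mapᵂ hom p , λ ℓ q → subst (_≤ ℓ) (sym (Dist⇒≡dist D)) (no-shortcut q)) ,
    λ (q , minimal) →
      subst (Dist G u v) (≤-antisym (no-shortcut q) (minimal _ (mapᵂ hom (proj₁ (dist-Dist u v)))))
            (dist-Dist u v)

Chromatic-supergraph : ∀ {n m k} {G : Graph n} {G' : Graph m} {f : Fin n → Fin m} →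
  Homomorphism G G' f → Chromatic G k → Colourable G' k → Chromatic G' k
Chromatic-supergraph {f = f} hom (_ , minimal) colourable =
  colourable , λ m' (c , proper) → minimal m' (c ∘ f , λ u v e → proper (f u) (f v) (hom u v e))

two-other-colours : ∀ {k} → 3 ≤ k → (q : Fin k) → ∃[ α ] ∃[ β ] α ≢ β × α ≢ q × β ≢ q
two-other-colours (s≤s (s≤s (s≤s _))) zero = suc zero , suc (suc zero) , (λ ()) , (λ ()) , (λ ())
two-other-colours (s≤s (s≤s (s≤s _))) (suc zero) = zero , suc (suc zero) , (λ ()) , (λ ()) , (λ ())
two-other-colours (s≤s (s≤s (s≤s _))) (suc (suc q)) = zero , suc zero , (λ ()) , (λ ()) , (λ ())

from-does : ∀ {A : Set} (a? : Dec A) → does a? ≡ true → A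
from-does (yes a) _ = a

inject₁≢suc : ∀ {L} (t : Fin L) → inject₁ t ≢ suc t
inject₁≢suc zero ()
inject₁≢suc (suc t) eq = inject₁≢suc t (sucᶠ-injective eq)

pattern hub = inj₁ zero
pattern old x = inj₁ (suc x)
pattern link y t = inj₂ (y , t)

-- G plus a hub adjacent to Z and, for every y, a path hub, link y 0, …, link y L;
-- only the paths with Y y are joined to y, the others just hang off the hub.
module Gadget {n} (G : Graph n) (conn : Connected G) {Z Y : Pred (Fin n) 0ℓ}
              (Z? : Decidable Z) (Y? : Decidable Y) (L : ℕ) where

  V : Set
  V = Fin (suc n) ⊎ (Fin n × Fin (suc L))

  N : ℕ
  N = suc (suc L)

  data _⇀_ : V → V → Set where
    edge       : ∀ {x y} → Edge G x y → old x ⇀ old y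
    spoke      : ∀ {x} → Z x → hub ⇀ old x
    path-start : ∀ {y} → hub ⇀ link y zero
    path-step  : ∀ {y} (t : Fin L) → link y (inject₁ t) ⇀ link y (suc t)
    path-end   : ∀ {y} → Y y → link y (fromℕ L) ⇀ old y

  _⇀?_ : ∀ a b → Dec (a ⇀ b)
  hub ⇀? hub = no λ ()
  hub ⇀? old x = map′ spoke (λ { (spoke z) → z }) (Z? x)
  hub ⇀? link y zero = yes path-start
  hub ⇀? link y (suc t) = no λ ()
  old x ⇀? hub = no λ ()
  old x ⇀? old y = map′ edge (λ { (edge e) → e }) (adj G x y ≟ᵇ true)
  old x ⇀? link y t = no λ ()
  link y s ⇀? hub = no λ ()
  link y s ⇀? old x =
    map′ (λ { (refl , refl , yy) → path-end yy }) (λ { (path-end yy) → refl , refl , yy })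
         ((y ≟ᶠ x) ×-dec (s ≟ᶠ fromℕ L) ×-dec Y? y)
  link y s ⇀? link y' zero = no λ ()
  link y s ⇀? link y' (suc t) =
    map′ (λ { (refl , refl) → path-step t }) (λ { (path-step _) → refl , refl })
         ((y ≟ᶠ y') ×-dec (s ≟ᶠ inject₁ t))

  ⇀⇒≢ : ∀ {a b} → a ⇀ b → a ≢ b
  ⇀⇒≢ (edge e) refl = Edge-irrefl G e
  ⇀⇒≢ (path-step t) eq = inject₁≢suc t (,-injectiveʳ (inj₂-injective eq))

  _~_ : V → V → Set
  a ~ b = a ⇀ b ⊎ b ⇀ a

  _~?_ : ∀ a b → Dec (a ~ b)
  a ~? b = (a ⇀? b) ⊎-dec (b ⇀? a)

  ~-irrefl : ∀ {a} → ¬ a ~ a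
  ~-irrefl (inj₁ a⇀a) = ⇀⇒≢ a⇀a refl
  ~-irrefl (inj₂ a⇀a) = ⇀⇒≢ a⇀a refl

  m : ℕ
  m = suc n + n * suc L

  vertices : Fin m ↔ V
  vertices = (↔-refl ⊎-↔ *↔×) ↔-∘ +↔⊎

  open Distance G conn
  open Inverse vertices using () renaming (to to vertex; from to index;
    strictlyInverseˡ to vertex-index; strictlyInverseʳ to index-vertex)

  G⁺ : Graph m
  G⁺ = record
    { adj      = λ i j → does (vertex i ~? vertex j)
    ; adj-sym  = λ i j → ∨-comm (does (vertex i ⇀? vertex j)) (does (vertex j ⇀? vertex i))
    ; loopless = λ i → dec-false (vertex i ~? vertex i) ~-irrefl
    }

  Edge⁺⇒~ : ∀ {i j} → Edge G⁺ i j → vertex i ~ vertex j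
  Edge⁺⇒~ {i} {j} = from-does (vertex i ~? vertex j)

  ~⇒Edge⁺ : ∀ {a b} → a ~ b → Edge G⁺ (index a) (index b)
  ~⇒Edge⁺ {a} {b} a~b rewrite vertex-index a | vertex-index b = dec-true (a ~? b) a~b

  arc : ∀ {a b} → a ⇀ b → Edge G⁺ (index a) (index b)
  arc = ~⇒Edge⁺ ∘ inj₁

  arc-back : ∀ {a b} → a ⇀ b → Edge G⁺ (index b) (index a)
  arc-back = ~⇒Edge⁺ ∘ inj₂

  step-back : ∀ {a b v ℓ} → a ⇀ b → Walk G⁺ (index a) v ℓ → Walk G⁺ (index b) v (suc ℓ)
  step-back a⇀b = step (arc-back a⇀b)

  embed : Fin n → Fin m
  embed x = index (old x)

  embed-injective : Injective _≡_ _≡_ embed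
  embed-injective {x} {y} eq =
    sucᶠ-injective (inj₁-injective (trans (sym (vertex-index (old x))) (trans (cong vertex eq) (vertex-index (old y)))))

  embed-hom : Homomorphism G G⁺ embed
  embed-hom x y e = arc (edge e)

  potential-walk : (ψ : V → ℕ) → (∀ {a b} → a ⇀ b → Near 1 (ψ a) (ψ b)) →
                   ∀ {i j ℓ} → Walk G⁺ i j ℓ → ψ (vertex i) ≤ ℓ + ψ (vertex j)
  potential-walk ψ lip = walk-lipschitz {G = G⁺} (ψ ∘ vertex)
    λ {i} {j} e → [ (λ a⇀b → proj₁ (lip a⇀b)) , (λ b⇀a → proj₂ (lip b⇀a)) ] (Edge⁺⇒~ {i} {j} e)

  path-to-hub : ∀ y (t : Fin (suc L)) → Walk G⁺ (index (link y t)) (index hub) (suc (toℕ t))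
  path-to-hub y = <-weakInduction (λ t → Walk G⁺ (index (link y t)) (index hub) (suc (toℕ t)))
    (step-back (path-start {y}) here)
    λ t walk → step-back (path-step {y} t) (subst (PathWalk (inject₁ t)) (toℕ-inject₁ t) walk)
    where
    PathWalk : Fin (suc L) → ℕ → Set
    PathWalk t d = Walk G⁺ (index (link y t)) (index hub) (suc d)

  Y-to-hub : ∀ {y} → Y y → Walk G⁺ (embed y) (index hub) N
  Y-to-hub {y} yy = step-back (path-end {y} yy) (subst PathWalk (toℕ-fromℕ L) (path-to-hub y (fromℕ L)))
    where
    PathWalk : ℕ → Set
    PathWalk d = Walk G⁺ (index (link y (fromℕ L))) (index hub) (suc d)

  G⁺-connected : ∀ {v} → Z v → Connected G⁺
  G⁺-connected {v} zv i j =
    let ℓ , p = to-hub (vertex i)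
        ℓ' , q = to-hub (vertex j)
    in ℓ + ℓ' , subst₂ (λ i' j' → Walk G⁺ i' j' (ℓ + ℓ')) (index-vertex i) (index-vertex j) (p ++ᵂ reverse q)
    where
    to-hub : ∀ a → ∃ λ ℓ → Walk G⁺ (index a) (index hub) ℓ
    to-hub hub = _ , here
    to-hub (old x) = _ , (mapᵂ {G' = G⁺} {h = embed} embed-hom (proj₂ (conn x v)) ++ᵂ step-back (spoke zv) here)
    to-hub (link y t) = _ , path-to-hub y t

  -- ψ extends dist · b to G⁺ and changes by at most 1 along every edge,
  -- so no walk of G⁺ is shorter than the distance in G between its ends.
  module Potential (b : Fin n) (A : ℕ) (near-Z : ∀ {x} → Z x → Near 1 A (dist x b))
                   (near-Y : ∀ {y} → Y y → Near N A (dist y b)) where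

    top : Fin n → ℕ
    top y with Y? y
    ... | yes _ = dist y b
    ... | no _ = A

    top-near : ∀ y → Near N A (top y)
    top-near y with Y? y
    ... | yes yy = near-Y yy
    ... | no _ = m≤n+m A N , m≤n+m A N

    top-Y : ∀ {y} → Y y → top y ≡ dist y b
    top-Y {y} yy with Y? y
    ... | yes _ = refl
    ... | no ¬yy = ⊥-elim (¬yy yy)

    ψ : V → ℕ
    ψ hub = A
    ψ (old x) = dist x b
    ψ (link y t) = interpolate A (top y) N (suc (toℕ t))

    ψ-arc : ∀ {a a'} → a ⇀ a' → Near 1 (ψ a) (ψ a')
    ψ-arc (edge e) = dist-edge b e , dist-edge b (Edge-sym G e)
    ψ-arc (spoke z) = near-Z z
    ψ-arc (path-start {y}) =
      subst (λ a → Near 1 a (interpolate A (top y) N 1)) (interpolate-start (top-near y))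
            (interpolate-step A (top y) N 0)
    ψ-arc (path-step {y} t) rewrite toℕ-inject₁ t = interpolate-step A (top y) N (suc (toℕ t))
    ψ-arc (path-end {y} yy) rewrite toℕ-fromℕ L =
      subst (Near 1 (interpolate A (top y) N (suc L))) (trans (interpolate-end (top-near y)) (top-Y yy))
            (interpolate-step A (top y) N (suc L))

    no-shortcut-to : ∀ {a ℓ} → Walk G⁺ (embed a) (embed b) ℓ → dist a b ≤ ℓ
    no-shortcut-to {a} {ℓ} p with potential-walk ψ ψ-arc p
    ... | bound rewrite vertex-index (old a) | vertex-index (old b) | dist-self b | +-identityʳ ℓ = bound

  embed-isometric : (A : Fin n → ℕ) → (∀ b {x} → Z x → Near 1 (A b) (dist x b)) →
                    (∀ b {y} → Y y → Near N (A b) (dist y b)) → IsometricSubgraph G G⁺ embed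
  embed-isometric A near-Z near-Y = isometric-without-shortcuts conn embed-injective embed-hom
    λ {u} {v} → Potential.no-shortcut-to v (A v) (near-Z v) (near-Y v)

  module Colouring {k} (c : Fin n → Fin k) (proper : Proper G c) {q α β : Fin k}
                   (α≢β : α ≢ β) (α≢q : α ≢ q) (β≢q : β ≢ q)
                   (Z≢q : ∀ {x} → Z x → c x ≢ q) (Y≡q : ∀ {y} → Y y → c y ≡ q) where

    alternating : ℕ → Fin k
    alternating zero = α
    alternating (suc zero) = β
    alternating (suc (suc p)) = alternating p

    alternating≢q : ∀ p → alternating p ≢ q
    alternating≢q zero = α≢q
    alternating≢q (suc zero) = β≢q
    alternating≢q (suc (suc p)) = alternating≢q p

    alternating-suc : ∀ p → alternating p ≢ alternating (suc p)
    alternating-suc zero = α≢β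
    alternating-suc (suc zero) = ≢-sym α≢β
    alternating-suc (suc (suc p)) = alternating-suc p

    κ : V → Fin k
    κ hub = q
    κ (old x) = c x
    κ (link y t) = alternating (toℕ t)

    κ-arc : ∀ {a a'} → a ⇀ a' → κ a ≢ κ a'
    κ-arc (edge e) = proper _ _ e
    κ-arc (spoke z) = ≢-sym (Z≢q z)
    κ-arc path-start = ≢-sym α≢q
    κ-arc (path-step t) rewrite toℕ-inject₁ t = alternating-suc (toℕ t)
    κ-arc (path-end yy) rewrite Y≡q yy = alternating≢q (toℕ (fromℕ L))

    G⁺-colourable : Colourable G⁺ k
    G⁺-colourable = κ ∘ vertex , λ i j e → [ κ-arc , ≢-sym ∘ κ-arc ] (Edge⁺⇒~ {i} {j} e)

  retract-hub : ∀ {k} → 3 ≤ k → AbsRetract k G → ∀ {v} → Z v →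
    (A : Fin n → ℕ) → (∀ b {x} → Z x → Near 1 (A b) (dist x b)) →
    (∀ b {y} → Y y → Near N (A b) (dist y b)) →
    (c : Fin n → Fin k) → Proper G c → ∀ {q} → (∀ {x} → Z x → c x ≢ q) → (∀ {y} → Y y → c y ≡ q) →
    ∃[ w ] (∀ {x} → Z x → Edge G w x) × (∀ {y} → Y y → Walk G y w N)
  retract-hub {k} 3≤k (_ , χ , retracts) zv A near-Z near-Y c proper {q} Z≢q Y≡q =
    let α , β , α≢β , α≢q , β≢q = two-other-colours 3≤k q
        χ⁺ : Chromatic G⁺ k
        χ⁺ = Chromatic-supergraph {G = G} {G' = G⁺} {f = embed} embed-hom χ
               (Colouring.G⁺-colourable c proper α≢β α≢q β≢q Z≢q Y≡q)
        r , r-hom , r-embed = retracts m G⁺ embed (G⁺-connected zv) χ⁺ (embed-isometric A near-Z near-Y) χ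
    in r (index hub) ,
       (λ {x} z → subst (Edge G (r (index hub))) (r-embed x) (r-hom _ _ (arc (spoke z)))) ,
       (λ {y} yy → subst (λ y' → Walk G y' (r (index hub)) N) (r-embed y)
                            (mapᵂ {h = r} r-hom (Y-to-hub yy)))

module InAbsoluteRetract {k n} (3≤k : 3 ≤ k) {G : Graph n} (conn : Connected G) (AR : AbsRetract k G)
                         {c : Fin n → Fin k} (proper : Proper G c) where
  open Distance G conn
  open ColourDistances G conn c

  neighbour-of-each-colour : ∀ v {a} → a ≢ c v → ∃[ w ] Edge G v w × c w ≡ a
  -- Recolouring v with the missing colour a frees c v for the hub, which is adjacent to N[v].
  neighbour-of-each-colour v {a} a≢cv with any? (λ w → (adj G v w ≟ᵇ true) ×-dec (c w ≟ᶠ a))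
  ... | yes found = found
  ... | no none = ⊥-elim (Edge-irrefl G (hub-adj (inj₂ (Edge-sym G (hub-adj (inj₁ refl))))))
    where
    Z : Pred (Fin n) _
    Z x = x ≡ v ⊎ Edge G v x

    Z? : Decidable Z
    Z? x = (x ≟ᶠ v) ⊎-dec (adj G v x ≟ᵇ true)

    open Gadget G conn Z? (∅? {A = Fin n}) 0

    recoloured : Fin n → Fin k
    recoloured x with x ≟ᶠ v
    ... | yes _ = a
    ... | no _ = c x

    recoloured-proper : Proper G recoloured
    recoloured-proper x y e with x ≟ᶠ v | y ≟ᶠ v
    ... | yes refl | yes refl = ⊥-elim (Edge-irrefl G e)
    ... | yes refl | no _ = λ a≡cy → none (y , e , sym a≡cy)
    ... | no _ | yes refl = λ cx≡a → none (x , Edge-sym G e , cx≡a)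
    ... | no _ | no _ = proper x y e

    Z≢cv : ∀ {x} → Z x → recoloured x ≢ c v
    Z≢cv {x} zx with x ≟ᶠ v | zx
    ... | yes refl | _ = a≢cv
    ... | no x≢v | inj₁ x≡v = ⊥-elim (x≢v x≡v)
    ... | no _ | inj₂ e = ≢-sym (proper v x e)

    Z-near : ∀ b {x} → Z x → Near 1 (dist v b) (dist x b)
    Z-near b (inj₁ refl) = n≤1+n _ , n≤1+n _
    Z-near b (inj₂ e) = dist-edge b e , dist-edge b (Edge-sym G e)

    hub-image : ∃[ w ] (∀ {x} → Z x → Edge G w x) × (∀ {y} → y ∈ ∅ → Walk G y w N)
    hub-image = retract-hub 3≤k AR (inj₁ refl) (λ b → dist v b) Z-near (λ _ ())
                            recoloured recoloured-proper Z≢cv (λ ())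

    hub-adj : ∀ {x} → Z x → Edge G (proj₁ hub-image) x
    hub-adj = proj₁ (proj₂ hub-image)

  neighbour-near-colour-class : ∀ {v j} → c v ≢ j → ∀ L → (∀ x y → dist x y ≤ 3 + L) →
    ∃[ w ] Edge G v w × c w ≡ j × (∀ {y} → c y ≡ j → Walk G y w (2 + L))
  neighbour-near-colour-class {v} {j} cv≢j L short =
    w , vw , decidable-stable (c w ≟ᶠ j) cw≢j⇒⊥ , proj₂ (proj₂ hub-image)
    where
    Z : Pred (Fin n) _
    Z x = x ≡ v ⊎ (Edge G v x × c x ≢ j)

    Z? : Decidable Z
    Z? x = (x ≟ᶠ v) ⊎-dec ((adj G v x ≟ᵇ true) ×-dec ¬? (c x ≟ᶠ j))

    open Gadget G conn Z? (λ x → c x ≟ᶠ j) L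

    Z-near-v : ∀ b {x} → Z x → Near 1 (dist v b) (dist x b)
    Z-near-v b (inj₁ refl) = n≤1+n _ , n≤1+n _
    Z-near-v b (inj₂ (e , _)) = dist-edge b e , dist-edge b (Edge-sym G e)

    -- The distance from b to the hub: dist v b, clipped to [1, N] so as to stay
    -- within N of the distance from b to any vertex of colour j.
    A : Fin n → ℕ
    A b = (dist v b ⊓ N) ⊔ 1

    Z-near : ∀ b {x} → Z x → Near 1 (A b) (dist x b)
    Z-near b {x} zx =
      ⊔-lub (≤-trans (m⊓n≤m _ N) (proj₁ (Z-near-v b zx))) (s≤s z≤n) ,
      ≤-trans (⊓-glb (proj₂ (Z-near-v b zx)) (short x b)) (s≤s (m≤m⊔n _ 1))

    Y-near : ∀ b {y} → c y ≡ j → Near N (A b) (dist y b)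
    Y-near b {y} _ =
      ≤-trans (⊔-lub (m⊓n≤n _ N) (s≤s z≤n)) (m≤m+n N _) ,
      ≤-trans (short y b) (subst (_≤ N + A b) (+-comm N 1) (+-monoʳ-≤ N (m≤n⊔m _ 1)))

    Z≢j : ∀ {x} → Z x → c x ≢ j
    Z≢j (inj₁ refl) = cv≢j
    Z≢j (inj₂ (_ , cx≢j)) = cx≢j

    hub-image : ∃[ w ] (∀ {x} → Z x → Edge G w x) × (∀ {y} → c y ≡ j → Walk G y w N)
    hub-image = retract-hub 3≤k AR (inj₁ refl) A Z-near Y-near c proper Z≢j (λ cy≡j → cy≡j)

    w : Fin n
    w = proj₁ hub-image

    vw : Edge G v w
    vw = Edge-sym G (proj₁ (proj₂ hub-image) (inj₁ refl))

    cw≢j⇒⊥ : c w ≢ j → ⊥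
    cw≢j⇒⊥ cw≢j = Edge-irrefl G (proj₁ (proj₂ hub-image) (inj₂ (vw , cw≢j)))

  PeripheralConfiguration : ℕ → Set
  PeripheralConfiguration M =
    Σ (Fin k) λ i → Σ (Fin k) λ j → i ≢ j × ColourDiam G c i M × ColourDiam G c j M ×
      (Σ (Fin n) λ v → Peripheral G c i v × (∀ w → Edge G v w → c w ≡ j → Peripheral G c j w))

  module Diameters {M D} (max : MaxColourDiam G c M) (diam : Diam G D) where

    M≤D : M ≤ D
    M≤D = let (_ , (v , _ , (u , _ , Duv) , _) , _) , _ = max in proj₂ diam u v M Duv

    dist≤D : ∀ x y → dist x y ≤ D
    dist≤D x y = proj₂ diam x y (dist x y) (dist-Dist x y)

    D≤suc-M : D ≤ suc M
    D≤suc-M with proj₁ diam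
    ... | u , v , Duv with c u ≟ᶠ c v
    ...   | yes cu≡cv = ≤-trans (sameColour⇒dist≤ max cu≡cv Duv) (n≤1+n M)
    ...   | no cu≢cv =
      let w , vw , cw≡cu = neighbour-of-each-colour v cu≢cv
      in ≤-trans (Dist≤suc-dist Duv (Edge-sym G vw))
                 (s≤s (sameColour⇒dist≤ max (sym cw≡cu) (dist-Dist u w)))

    diam-suc⇒configuration : D ≡ suc M → PeripheralConfiguration M
    diam-suc⇒configuration D≡1+M with proj₁ diam
    ... | u , v , Duv with c u ≟ᶠ c v
    ...   | yes cu≡cv = ⊥-elim (1+n≰n (subst (_≤ M) D≡1+M (sameColour⇒dist≤ max cu≡cv Duv)))
    ...   | no cu≢cv =
      let w , vw , cw≡cu = neighbour-of-each-colour v cu≢cv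
          w' , uw' , cw'≡cv = neighbour-of-each-colour u (≢-sym cu≢cv)
          CDj , _ = far⇒peripheral max refl cw≡cu (far-from-u Duv vw)
          CDi , Ei = far⇒peripheral max cw'≡cv refl
                       (subst (M ≤_) (dist-sym v w') (far-from-u (Dist-sym Duv) uw'))
      in c v , c u , ≢-sym cu≢cv , CDi , CDj , v , (refl , M , CDi , Ei) ,
         λ z vz cz≡cu → cz≡cu , M , far⇒peripheral max refl cz≡cu (far-from-u Duv vz)
      where
      far-from-u : ∀ {x y z} → Dist G x y D → Edge G y z → M ≤ dist x z
      far-from-u Dxy yz = ≤-pred (subst (_≤ suc (dist _ _)) D≡1+M (Dist≤suc-dist Dxy (Edge-sym G yz)))

    some-neighbour-not-peripheral : 3 ≤ D → D ≤ M → ∀ {j} → ColourDiam G c j M → ∀ {v} → c v ≢ j →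
                                    ¬ (∀ w → Edge G v w → c w ≡ j → Peripheral G c j w)
    some-neighbour-not-peripheral 3≤D D≤M CDj cv≢j all-peripheral =
      let w , vw , cw≡j , near = neighbour-near-colour-class cv≢j L dist≤3+L
          _ , _ , CD , (u , cu≡j , Duw) , _ = all-peripheral w vw cw≡j
      in 1+n≰n (subst (_≤ 2 + L) (trans (ColourDiam-unique CD CDj) M≡3+L) (proj₂ Duw _ (near cu≡j)))
      where
      L : ℕ
      L = M ∸ 3

      M≡3+L : M ≡ 3 + L
      M≡3+L = sym (m+[n∸m]≡n (≤-trans 3≤D D≤M))

      dist≤3+L : ∀ x y → dist x y ≤ 3 + L
      dist≤3+L x y = subst (dist x y ≤_) M≡3+L (≤-trans (dist≤D x y) D≤M)

    configuration⇒diam-suc : 3 ≤ D → M ≡ 2 ⊎ PeripheralConfiguration M → D ≡ suc M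
    configuration⇒diam-suc 3≤D (inj₁ refl) = ≤-antisym D≤suc-M 3≤D
    configuration⇒diam-suc 3≤D (inj₂ (i , j , i≢j , _ , CDj , v , (cv≡i , _) , all-peripheral))
      with D ≟ suc M
    ... | yes D≡1+M = D≡1+M
    ... | no D≢1+M = ⊥-elim (some-neighbour-not-peripheral 3≤D (≤-pred (≤∧≢⇒< D≤suc-M D≢1+M)) CDj
                                                           (subst (_≢ j) (sym cv≡i) i≢j) all-peripheral)

lemma30 : (k : ℕ) → 3 ≤ k → (n : ℕ) → (G : Graph n) → Connected G → AbsRetract k G →
  (c : Fin n → Fin k) → Proper G c →
  (M D : ℕ) → MaxColourDiam G c M → Diam G D →
  (M ≤ D × D ≤ suc M) ×
  (3 ≤ D →
    (D ≡ suc M ⇔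
      (M ≡ 2 ⊎
        (Σ (Fin k) λ i → Σ (Fin k) λ j → i ≢ j × ColourDiam G c i M × ColourDiam G c j M ×
          (Σ (Fin n) λ v → Peripheral G c i v ×
            (∀ w → Edge G v w → c w ≡ j → Peripheral G c j w))))))
lemma30 k 3≤k n G conn AR c proper M D max diam =
  (M≤D , D≤suc-M) , λ 3≤D → mk⇔ (inj₂ ∘ diam-suc⇒configuration) (configuration⇒diam-suc 3≤D)
  where open InAbsoluteRetract 3≤k conn AR proper
        open Diameters max diam
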